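{- Let $n,t$ be positive integers, $k\in\{0,1,\dots,n\}$, and let $N$ be an integer point of $t\mathcal{M}_k(K_{n,n})$. Then the graph induced by $N$ has a $k$-matching $M$ (viewed as an $n\times n$ $0/1$ matrix) such that $N-M\in(t-1)\mathcal{M}_k(K_{n,n})$.
   Context: Identify $K_{n,n}$ with vertex classes $\{a_1,\dots,a_n\}$, $\{b_1,\dots,b_n\}$; a matching is represented by the $n\times n$ $0/1$ matrix with a $1$ in entry $(i,j)$ iff $\{a_i,b_j\}$ is in the matching, and a $k$-matching is a matching with exactly $k$ edges. $\mathcal{M}_k(K_{n,n})$ is the convex hull of all $k$-matchings of $K_{n,n}$ as such matrices; equivalently it is the set of real $n\times n$ matrices with nonnegative entries, all row and column sums at most $1$, and total entry sum $k$. Thus $s\mathcal{M}_k(K_{n,n})$ (for $s\ge 0$) is the set of nonnegative real matrices with all row and column sums at most $s$ and total sum $sk$. The graph induced by a nonnegative integer matrix $N$ is the bipartite graph on the same vertices with $\{a_i,b_j\}$ an edge iff $N_{ij}\neq0$. -}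

module Defs where

open import Data.Nat using (ℕ; zero; suc; _+_; _*_; _∸_; _≤_)
open import Data.Fin using (Fin; zero; suc)
open import Data.Product using (_×_)
open import Data.Sum using (_⊎_)
open import Relation.Binary.PropositionalEquality using (_≡_; _≢_)

∑ : ∀ {n} → (Fin n → ℕ) → ℕ
∑ {zero}  f = 0
∑ {suc n} f = f zero + ∑ (λ i → f (suc i))

-- n×n matrices with nonnegative integer entries; entry (i,j) ↔ edge {a_i,b_j}
Matrix : ℕ → Set
Matrix n = Fin n → Fin n → ℕ

rowSum : ∀ {n} → Matrix n → Fin n → ℕ
rowSum N i = ∑ (λ j → N i j)

colSum : ∀ {n} → Matrix n → Fin n → ℕ
colSum N j = ∑ (λ i → N i j)

totalSum : ∀ {n} → Matrix n → ℕ
totalSum N = ∑ (λ i → rowSum N i)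

-- N ∈ s·M_k(K_{n,n}) (entries are nonnegative integers, so this is
-- exactly membership of an integer point): row and column sums ≤ s,
-- total sum s·k.
InScaledMatchingPolytope : ∀ {n} → ℕ → ℕ → Matrix n → Set
InScaledMatchingPolytope s k N =
  (∀ i → rowSum N i ≤ s) × (∀ j → colSum N j ≤ s) × (totalSum N ≡ s * k)

IsKMatching : ∀ {n} → ℕ → Matrix n → Set
IsKMatching k M =
  (∀ i j → (M i j ≡ 0) ⊎ (M i j ≡ 1))
  × (∀ i → rowSum M i ≤ 1)
  × (∀ j → colSum M j ≤ 1)
  × (totalSum M ≡ k)

InInducedGraph : ∀ {n} → Matrix n → Matrix n → Set
InInducedGraph N M = ∀ i j → M i j ≡ 1 → N i j ≢ 0

-- entrywise difference (a genuine difference when M ≤ N entrywise,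
-- which holds for a 0/1 matrix M supported in the graph induced by N)
_⊖_ : ∀ {n} → Matrix n → Matrix n → Matrix n
(N ⊖ M) i j = N i j ∸ M i j

-- Pad N with a slack row and column, B = [[0, t − colSum N], [t − rowSum N, N]]. Every line sum
-- of B is a multiple of t (the slack row and column sum to t (n − k)). Such a nonnegative integer
-- matrix can be divided by t without enlarging its support: as long as some entry is not a
-- multiple of t, no line contains exactly one such entry, so these entries contain a cycle
-- alternating between rows and columns; moving the least lowered entry δ around the cycle keeps
-- all line sums and the support, and zeroes that entry. When every entry is a multiple of t,
-- divide entrywise. The quotient Q has line sums 1 on the lines of N, so its N-block M is a
-- matching supported in N. A line of N missed by M has a positive slack entry in Q, hence was not
-- tight, so every line of N − M sums to at most t − 1; and the slack column of Q counts the
-- n − k unmatched rows, so M has k edges.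
module Submission where

open import Defs
open import Data.Fin as Fin using (Fin; zero; suc; toℕ; inject₁; fromℕ; punchIn)
import Data.Fin.Properties as Fin
open import Data.Nat using (ℕ; zero; suc; _+_; _*_; _∸_; _≤_; _<_; z≤n; s≤s; NonZero; ≢-nonZero; _≟_)
open import Data.Nat.DivMod using (_/_; m*[n/m]≡n; 0/n≡0)
open import Data.Nat.Divisibility using (_∣_; _∣?_; _∣0; ∣-refl; ∣m∣n⇒∣m+n; ∣m+n∣m⇒∣n; m∣m*n)
open import Data.Nat.Induction using (<-wellFounded)
open import Data.Nat.Properties
open import Algebra.Properties.CommutativeMonoid.Sum +-0-commutativeMonoid as Sum
  using (sum)
import Algebra.Properties.Semiring.Sum +-*-semiring as SemiringSum
open import Data.Product using (Σ; _×_; _,_; proj₁; proj₂; ∃)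
open import Data.Sum using (_⊎_; inj₁; inj₂)
open import Function using (_∘_)
open import Induction.WellFounded using (Acc; acc)
open import Relation.Binary.Definitions using (tri<; tri≈; tri>)
open import Relation.Nullary using (¬_; Dec; yes; no; contradiction)
open import Relation.Nullary.Decidable using (¬?; _×-dec_; decidable-stable)
open import Relation.Unary using (Decidable)
open import Relation.Binary.PropositionalEquality hiding ([_])

open ≡-Reasoning

∑≡sum : ∀ {n} (f : Fin n → ℕ) → ∑ f ≡ sum f
∑≡sum {zero}  f = refl
∑≡sum {suc n} f = cong (f zero +_) (∑≡sum (f ∘ suc))

∑-cong : ∀ {n} {f g : Fin n → ℕ} → (∀ i → f i ≡ g i) → ∑ f ≡ ∑ g
∑-cong {zero}  f≗g = refl
∑-cong {suc n} f≗g = cong₂ _+_ (f≗g zero) (∑-cong (f≗g ∘ suc))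

∑-zero : ∀ {n} {f : Fin n → ℕ} → (∀ i → f i ≡ 0) → ∑ f ≡ 0
∑-zero {zero}  f≗0 = refl
∑-zero {suc n} f≗0 = cong₂ _+_ (f≗0 zero) (∑-zero (f≗0 ∘ suc))

∑-const : ∀ {n} c → ∑ {n} (λ _ → c) ≡ n * c
∑-const {zero}  c = refl
∑-const {suc n} c = cong (c +_) (∑-const {n} c)

∑-distrib-+ : ∀ {n} (f g : Fin n → ℕ) → ∑ (λ i → f i + g i) ≡ ∑ f + ∑ g
∑-distrib-+ f g = begin
  ∑ (λ i → f i + g i)    ≡⟨ ∑≡sum (λ i → f i + g i) ⟩
  sum (λ i → f i + g i)  ≡⟨ Sum.∑-distrib-+ f g ⟩
  sum f + sum g          ≡⟨ cong₂ _+_ (∑≡sum f) (∑≡sum g) ⟨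
  ∑ f + ∑ g              ∎

∑-comm : ∀ {m n} (f : Fin m → Fin n → ℕ) → ∑ (λ i → ∑ (f i)) ≡ ∑ (λ j → ∑ (λ i → f i j))
∑-comm f = begin
  ∑ (λ i → ∑ (f i))                ≡⟨ trans (∑≡sum (λ i → ∑ (f i))) (Sum.sum-cong-≗ (∑≡sum ∘ f)) ⟩
  sum (λ i → sum (f i))            ≡⟨ Sum.∑-comm f ⟩
  sum (λ j → sum (λ i → f i j))    ≡⟨ trans (∑≡sum (λ j → ∑ (λ i → f i j))) (Sum.sum-cong-≗ (λ j → ∑≡sum (λ i → f i j))) ⟨
  ∑ (λ j → ∑ (λ i → f i j))        ∎

*-distribˡ-∑ : ∀ {n} d (f : Fin n → ℕ) → d * ∑ f ≡ ∑ (λ i → d * f i)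
*-distribˡ-∑ d f = begin
  d * ∑ f                ≡⟨ cong (d *_) (∑≡sum f) ⟩
  d * sum f              ≡⟨ SemiringSum.*-distribˡ-sum d f ⟩
  sum (λ i → d * f i)    ≡⟨ ∑≡sum (λ i → d * f i) ⟨
  ∑ (λ i → d * f i)      ∎

∑-init-last : ∀ {n} (f : Fin (suc n) → ℕ) → ∑ f ≡ ∑ (f ∘ inject₁) + f (fromℕ n)
∑-init-last f = begin
  ∑ f                                  ≡⟨ ∑≡sum f ⟩
  sum f                                ≡⟨ Sum.sum-init-last f ⟩
  sum (f ∘ inject₁) + f (fromℕ _)      ≡⟨ cong (_+ f (fromℕ _)) (∑≡sum (f ∘ inject₁)) ⟨
  ∑ (f ∘ inject₁) + f (fromℕ _)        ∎

∑-remove : ∀ {n} (f : Fin (suc n) → ℕ) i → ∑ f ≡ f i + ∑ (f ∘ punchIn i)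
∑-remove f i = begin
  ∑ f                        ≡⟨ ∑≡sum f ⟩
  sum f                      ≡⟨ Sum.sum-remove f ⟩
  f i + sum (f ∘ punchIn i)  ≡⟨ cong (f i +_) (∑≡sum (f ∘ punchIn i)) ⟨
  f i + ∑ (f ∘ punchIn i)    ∎

∑-rotate : ∀ n (g : ℕ → ℕ) → g n ≡ g 0 → ∑ {n} (λ a → g (suc (toℕ a))) ≡ ∑ {n} (g ∘ toℕ)
∑-rotate n g gn≡g0 = +-cancelˡ-≡ (g 0) _ _ (begin
  g 0 + ∑ {n} (λ a → g (suc (toℕ a)))            ≡⟨ ∑-init-last {n} (g ∘ toℕ) ⟩
  ∑ {n} (g ∘ toℕ ∘ inject₁) + g (toℕ (fromℕ n))  ≡⟨ cong₂ _+_ (∑-cong {n} (cong g ∘ Fin.toℕ-inject₁))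
                                                              (cong g (Fin.toℕ-fromℕ n)) ⟩
  ∑ {n} (g ∘ toℕ) + g n                          ≡⟨ cong (∑ {n} (g ∘ toℕ) +_) gn≡g0 ⟩
  ∑ {n} (g ∘ toℕ) + g 0                          ≡⟨ +-comm _ (g 0) ⟩
  g 0 + ∑ {n} (g ∘ toℕ)                          ∎)

∑-∸ : ∀ {n} (f g : Fin n → ℕ) → (∀ i → g i ≤ f i) → ∑ (λ i → f i ∸ g i) + ∑ g ≡ ∑ f
∑-∸ f g g≤f = trans (sym (∑-distrib-+ _ g)) (∑-cong (λ i → m∸n+n≡m (g≤f i)))

∑-mono-≤ : ∀ {n} {f g : Fin n → ℕ} → (∀ i → f i ≤ g i) → ∑ f ≤ ∑ g
∑-mono-≤ {zero}  f≤g = z≤n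
∑-mono-≤ {suc n} f≤g = +-mono-≤ (f≤g zero) (∑-mono-≤ (f≤g ∘ suc))

∑-mono-< : ∀ {n} {f g : Fin n → ℕ} → (∀ i → f i ≤ g i) → ∀ i → f i < g i → ∑ f < ∑ g
∑-mono-< f≤g zero    fi<gi = +-mono-<-≤ fi<gi (∑-mono-≤ (f≤g ∘ suc))
∑-mono-< f≤g (suc i) fi<gi = +-mono-≤-< (f≤g zero) (∑-mono-< (f≤g ∘ suc) i fi<gi)

≤-∑ : ∀ {n} (f : Fin n → ℕ) i → f i ≤ ∑ f
≤-∑ f zero    = m≤m+n _ _
≤-∑ f (suc i) = ≤-trans (≤-∑ (f ∘ suc) i) (m≤n+m _ (f zero))

∑≢0⇒∃≢0 : ∀ {n} (f : Fin n → ℕ) → ∑ f ≢ 0 → ∃ λ i → f i ≢ 0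
∑≢0⇒∃≢0 {zero}  f ∑f≢0 = contradiction refl ∑f≢0
∑≢0⇒∃≢0 {suc n} f ∑f≢0 with f zero ≟ 0
... | no  f0≢0 = zero , f0≢0
... | yes f0≡0 with ∑≢0⇒∃≢0 (f ∘ suc) (λ ∑≡0 → ∑f≢0 (cong₂ _+_ f0≡0 ∑≡0))
...   | i , fi≢0 = suc i , fi≢0

∑-≤1 : ∀ {n} (f : Fin n → ℕ) → (∀ i → f i ≤ 1)
     → (∀ i j → f i ≢ 0 → f j ≢ 0 → i ≡ j) → ∑ f ≤ 1
∑-≤1 {zero}  f f≤1 unique = z≤n
∑-≤1 {suc n} f f≤1 unique with f zero ≟ 0
... | yes f0≡0 = subst (λ x → x + ∑ (f ∘ suc) ≤ 1) (sym f0≡0)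
                   (∑-≤1 (f ∘ suc) (f≤1 ∘ suc) (λ i j fi fj → Fin.suc-injective (unique _ _ fi fj)))
... | no  f0≢0 = subst (λ x → f zero + x ≤ 1) (sym (∑-zero rest≡0))
                   (subst (_≤ 1) (sym (+-identityʳ _)) (f≤1 zero))
  where
  rest≡0 : ∀ i → f (suc i) ≡ 0
  rest≡0 i with f (suc i) ≟ 0
  ... | yes fi≡0 = fi≡0
  ... | no  fi≢0 with unique zero (suc i) f0≢0 fi≢0
  ...   | ()

∣-∑ : ∀ {n d} (f : Fin n → ℕ) → (∀ i → d ∣ f i) → d ∣ ∑ f
∣-∑ {zero}  f d∣f = _ ∣0
∣-∑ {suc n} f d∣f = ∣m∣n⇒∣m+n (d∣f zero) (∣-∑ (f ∘ suc) (d∣f ∘ suc))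

∑-shift : ∀ {n} δ (b u v : Fin n → ℕ) → (∀ i → δ * v i ≤ b i + δ * u i) → ∑ v ≡ ∑ u
        → ∑ (λ i → b i + δ * u i ∸ δ * v i) ≡ ∑ b
∑-shift δ b u v δv≤b+δu ∑v≡∑u = +-cancelʳ-≡ (δ * ∑ u) _ _ (begin
  ∑ (λ i → b i + δ * u i ∸ δ * v i) + δ * ∑ u            ≡⟨ cong (λ x → ∑ (λ i → b i + δ * u i ∸ δ * v i) + δ * x) ∑v≡∑u ⟨
  ∑ (λ i → b i + δ * u i ∸ δ * v i) + δ * ∑ v            ≡⟨ cong (∑ (λ i → b i + δ * u i ∸ δ * v i) +_) (*-distribˡ-∑ δ v) ⟩
  ∑ (λ i → b i + δ * u i ∸ δ * v i) + ∑ (λ i → δ * v i)  ≡⟨ ∑-∸ (λ i → b i + δ * u i) (λ i → δ * v i) δv≤b+δu ⟩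
  ∑ (λ i → b i + δ * u i)                                ≡⟨ ∑-distrib-+ b (λ i → δ * u i) ⟩
  ∑ b + ∑ (λ i → δ * u i)                                ≡⟨ cong (∑ b +_) (*-distribˡ-∑ δ u) ⟨
  ∑ b + δ * ∑ u                                          ∎)

[_] : ∀ {a} {A : Set a} → Dec A → ℕ
[ yes _ ] = 1
[ no  _ ] = 0

[]-≤1 : ∀ {a} {A : Set a} (d : Dec A) → [ d ] ≤ 1
[]-≤1 (yes _) = s≤s z≤n
[]-≤1 (no  _) = z≤n

[]-yes : ∀ {a} {A : Set a} (d : Dec A) → A → [ d ] ≡ 1
[]-yes (yes _) _ = refl
[]-yes (no ¬a) a = contradiction a ¬a

[]-no : ∀ {a} {A : Set a} (d : Dec A) → ¬ A → [ d ] ≡ 0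
[]-no (yes a) ¬a = contradiction a ¬a
[]-no (no  _) _  = refl

[]≢0 : ∀ {a} {A : Set a} (d : Dec A) → [ d ] ≢ 0 → A
[]≢0 (yes a) _   = a
[]≢0 (no  _) 0≢0 = contradiction refl 0≢0

[×-dec] : ∀ {a b} {A : Set a} {B : Set b} (d : Dec A) (e : Dec B) → [ d ×-dec e ] ≡ [ d ] * [ e ]
[×-dec] (yes _) (yes _) = refl
[×-dec] (yes _) (no  _) = refl
[×-dec] (no  _) _       = refl

∑-[≟] : ∀ {n} (i : Fin n) → ∑ (λ j → [ i Fin.≟ j ]) ≡ 1
∑-[≟] {suc n} i = begin
  ∑ (λ j → [ i Fin.≟ j ])                                ≡⟨ ∑-remove (λ j → [ i Fin.≟ j ]) i ⟩
  [ i Fin.≟ i ] + ∑ (λ j → [ i Fin.≟ punchIn i j ])      ≡⟨ cong₂ _+_ ([]-yes (i Fin.≟ i) refl)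
                                                              (∑-zero (λ j → []-no (i Fin.≟ _) (Fin.punchInᵢ≢i i j ∘ sym))) ⟩
  1                                                      ∎

∑-[×-dec-≟] : ∀ {n a} {A : Set a} (d : Dec A) (i : Fin n) → ∑ (λ j → [ d ×-dec (i Fin.≟ j) ]) ≡ [ d ]
∑-[×-dec-≟] d i = begin
  ∑ (λ j → [ d ×-dec (i Fin.≟ j) ])   ≡⟨ ∑-cong (λ j → [×-dec] d (i Fin.≟ j)) ⟩
  ∑ (λ j → [ d ] * [ i Fin.≟ j ])     ≡⟨ *-distribˡ-∑ [ d ] (λ j → [ i Fin.≟ j ]) ⟨
  [ d ] * ∑ (λ j → [ i Fin.≟ j ])     ≡⟨ cong ([ d ] *_) (∑-[≟] i) ⟩
  [ d ] * 1                           ≡⟨ *-identityʳ _ ⟩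
  [ d ]                               ∎

∑-[≟-×-dec] : ∀ {n a} {A : Set a} (i : Fin n) (d : Dec A) → ∑ (λ j → [ (i Fin.≟ j) ×-dec d ]) ≡ [ d ]
∑-[≟-×-dec] i d = trans (∑-cong λ j → trans ([×-dec] (i Fin.≟ j) d)
                                        (trans (*-comm _ [ d ]) (sym ([×-dec] d (i Fin.≟ j)))))
                        (∑-[×-dec-≟] d i)

∣∑⇒∤-elsewhere : ∀ {n d} (f : Fin n → ℕ) i → d ∣ ∑ f → ¬ d ∣ f i → ∃ λ j → j ≢ i × ¬ d ∣ f j
∣∑⇒∤-elsewhere {suc n} {d} f i d∣∑f d∤fi with Fin.any? (λ j → ¬? (d ∣? f (punchIn i j)))
... | yes (j , d∤fj) = punchIn i j , Fin.punchInᵢ≢i i j , d∤fj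
... | no  none = contradiction (∣m+n∣m⇒∣n d∣rest+fi (∣-∑ _ d∣rest)) d∤fi
  where
  d∣rest : ∀ j → d ∣ f (punchIn i j)
  d∣rest j = decidable-stable (d ∣? _) (λ d∤fj → none (j , d∤fj))
  d∣rest+fi : d ∣ ∑ (f ∘ punchIn i) + f i
  d∣rest+fi = subst (d ∣_) (trans (∑-remove f i) (+-comm (f i) _)) d∣∑f

module _ {p} {P : ℕ → Set p} (P? : Decidable P) where

  least : ∀ {m} → P m → ∃ λ k → P k × (∀ j → j < k → ¬ P j)
  least = go (<-wellFounded _)
    where
    go : ∀ {m} → Acc _<_ m → P m → ∃ λ k → P k × (∀ j → j < k → ¬ P j)
    go {m} (acc rs) Pm with anyUpTo? P? m
    ... | yes (j , j<m , Pj) = go (rs j<m) Pj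
    ... | no  none           = m , Pm , λ j j<m Pj → none (j , j<m , Pj)

argmin : ∀ {n p} {P : Fin n → Set p} → Decidable P → (f : Fin n → ℕ)
       → ∃ P → ∃ λ a → P a × (∀ b → P b → f a ≤ f b)
argmin {P = P} P? f (a , Pa) with least (λ v → Fin.any? (λ b → P? b ×-dec f b ≟ v)) (a , Pa , refl)
... | _ , (a* , Pa* , refl) , below = a* , Pa* , λ b Pb → ≮⇒≥ (λ fb<fa* → below _ fb<fa* (b , Pb , refl))

-- Shifting along an alternating cycle

_⊆supp_ : ∀ {n} → Matrix n → Matrix n → Set
A ⊆supp B = ∀ i j → A i j ≢ 0 → B i j ≢ 0

SameLineSums : ∀ {n} → Matrix n → Matrix n → Set
SameLineSums A B = (∀ i → rowSum A i ≡ rowSum B i) × (∀ j → colSum A j ≡ colSum B j)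

nondivisibleCount : ∀ {n} → ℕ → Matrix n → ℕ
nondivisibleCount t B = ∑ λ i → ∑ λ j → [ ¬? (t ∣? B i j) ]

cellCount : ∀ {m n} → (Fin m → Fin n) → (Fin m → Fin n) → Matrix n
cellCount r c i j = ∑ λ a → [ (r a Fin.≟ i) ×-dec (c a Fin.≟ j) ]

rowSum-cellCount : ∀ {m n} (r c : Fin m → Fin n) i → rowSum (cellCount r c) i ≡ ∑ (λ a → [ r a Fin.≟ i ])
rowSum-cellCount r c i = trans (∑-comm (λ j a → [ (r a Fin.≟ i) ×-dec (c a Fin.≟ j) ]))
                               (∑-cong λ a → ∑-[×-dec-≟] (r a Fin.≟ i) (c a))

colSum-cellCount : ∀ {m n} (r c : Fin m → Fin n) j → colSum (cellCount r c) j ≡ ∑ (λ a → [ c a Fin.≟ j ])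
colSum-cellCount r c j = trans (∑-comm (λ i a → [ (r a Fin.≟ i) ×-dec (c a Fin.≟ j) ]))
                               (∑-cong λ a → ∑-[≟-×-dec] (r a) (c a Fin.≟ j))

cellCount-hit : ∀ {m n} (r c : Fin m → Fin n) {i j} → cellCount r c i j ≢ 0 → ∃ λ a → r a ≡ i × c a ≡ j
cellCount-hit r c {i} {j} count≢0 with ∑≢0⇒∃≢0 (λ a → [ (r a Fin.≟ i) ×-dec (c a Fin.≟ j) ]) count≢0
... | a , hit = a , []≢0 ((r a Fin.≟ i) ×-dec (c a Fin.≟ j)) hit

cellCount-≤1 : ∀ {m n} (r c : Fin m → Fin n) → (∀ a b → r a ≡ r b → a ≡ b) → ∀ i j → cellCount r c i j ≤ 1
cellCount-≤1 r c r-inj i j = ∑-≤1 _ (λ a → []-≤1 _) λ a b hitₐ hit_b →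
  r-inj a b (trans (proj₁ ([]≢0 ((r a Fin.≟ i) ×-dec (c a Fin.≟ j)) hitₐ))
                   (sym (proj₁ ([]≢0 ((r b Fin.≟ i) ×-dec (c b Fin.≟ j)) hit_b))))

-- Entries (row a, col a) are to be raised and (row (a + 1), col a) lowered, for a < 2 + len;
-- closed makes the row index cyclic.
record AlternatingCycle {p} (t : ℕ) (B : Matrix p) : Set where
  field
    len       : ℕ
    row col   : ℕ → Fin p
    closed    : row (2 + len) ≡ row 0
    row-inj   : ∀ {a b} → a < 2 + len → b < 2 + len → row a ≡ row b → a ≡ b
    col-turns : col 1 ≢ col 0
    ∤-raised  : ∀ a → a < 2 + len → ¬ t ∣ B (row a) (col a)
    ∤-lowered : ∀ a → a < 2 + len → ¬ t ∣ B (row (suc a)) (col a)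

module Shift {p t} {B : Matrix p} (C : AlternatingCycle t B) where
  open AlternatingCycle C

  L : ℕ
  L = 2 + len

  raisedRow loweredRow colAt : Fin L → Fin p
  raisedRow  = row ∘ toℕ
  loweredRow = row ∘ suc ∘ toℕ
  colAt      = col ∘ toℕ

  raised lowered : Matrix p
  raised  = cellCount raisedRow colAt
  lowered = cellCount loweredRow colAt

  row-suc-inj : ∀ {a b} → a < L → b < L → row (suc a) ≡ row (suc b) → a ≡ b
  row-suc-inj {a} {b} a<L b<L eq with m≤n⇒m<n∨m≡n a<L | m≤n⇒m<n∨m≡n b<L
  ... | inj₁ 1+a<L | inj₁ 1+b<L = suc-injective (row-inj 1+a<L 1+b<L eq)
  ... | inj₂ 1+a≡L | inj₂ 1+b≡L = suc-injective (trans 1+a≡L (sym 1+b≡L))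
  ... | inj₁ 1+a<L | inj₂ 1+b≡L =
    contradiction (row-inj (s≤s z≤n) 1+a<L (trans (sym closed) (trans (cong row (sym 1+b≡L)) (sym eq)))) (λ ())
  ... | inj₂ 1+a≡L | inj₁ 1+b<L =
    contradiction (row-inj (s≤s z≤n) 1+b<L (trans (sym closed) (trans (cong row (sym 1+a≡L)) eq))) (λ ())

  lowered-≤1 : ∀ i j → lowered i j ≤ 1
  lowered-≤1 = cellCount-≤1 loweredRow colAt λ a b eq →
    Fin.toℕ-injective (row-suc-inj (Fin.toℕ<n a) (Fin.toℕ<n b) eq)

  Lowering : Fin L → Set
  Lowering a = raised (loweredRow a) (colAt a) ≡ 0

  lowering-zero : Lowering zero
  lowering-zero = ∑-zero λ a → []-no ((raisedRow a Fin.≟ row 1) ×-dec (colAt a Fin.≟ col 0)) λ (row-eq , col-eq) →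
    col-turns (subst (λ b → col b ≡ col 0) (row-inj (Fin.toℕ<n a) (s≤s (s≤s z≤n)) row-eq) col-eq)

  -- The amount δ moved around the cycle is the least entry that is lowered without being raised.
  opaque
    pivot : ∃ λ a → Lowering a × (∀ b → Lowering b → B (loweredRow a) (colAt a) ≤ B (loweredRow b) (colAt b))
    pivot = argmin (λ a → raised (loweredRow a) (colAt a) ≟ 0) (λ a → B (loweredRow a) (colAt a)) (zero , lowering-zero)

  a* : Fin L
  a* = proj₁ pivot

  δ : ℕ
  δ = B (loweredRow a*) (colAt a*)

  shifted : Matrix p
  shifted i j = B i j + δ * raised i j ∸ δ * lowered i j

  δ-bounded : ∀ a → δ ≤ B (loweredRow a) (colAt a) + δ * raised (loweredRow a) (colAt a)
  δ-bounded a with raised (loweredRow a) (colAt a) ≟ 0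
  ... | yes r≡0 = ≤-trans (proj₂ (proj₂ pivot) a r≡0) (m≤m+n _ _)
  ... | no  r≢0 = ≤-trans (m≤m*n δ _ {{≢-nonZero r≢0}}) (m≤n+m _ _)

  lowered-bounded : ∀ i j → δ * lowered i j ≤ B i j + δ * raised i j
  lowered-bounded i j with lowered i j ≟ 0
  ... | yes l≡0 = subst (_≤ B i j + δ * raised i j) (sym (trans (cong (δ *_) l≡0) (*-zeroʳ δ))) z≤n
  ... | no  l≢0 with cellCount-hit loweredRow colAt l≢0
  ... | a , row≡i , col≡j =
    ≤-trans (*-monoʳ-≤ δ (lowered-≤1 i j))
            (subst (_≤ B i j + δ * raised i j) (sym (*-identityʳ δ))
                   (subst₂ (λ i j → δ ≤ B i j + δ * raised i j) row≡i col≡j (δ-bounded a)))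

  shifted-sums : SameLineSums shifted B
  shifted-sums =
      (λ i → ∑-shift δ (B i) (raised i) (lowered i) (lowered-bounded i) (rows-balanced i))
    , (λ j → ∑-shift δ (λ i → B i j) (λ i → raised i j) (λ i → lowered i j) (λ i → lowered-bounded i j)
                     (trans (colSum-cellCount loweredRow colAt j) (sym (colSum-cellCount raisedRow colAt j))))
    where
    rows-balanced : ∀ i → rowSum lowered i ≡ rowSum raised i
    rows-balanced i = begin
      rowSum lowered i                           ≡⟨ rowSum-cellCount loweredRow colAt i ⟩
      ∑ (λ a → [ loweredRow a Fin.≟ i ])          ≡⟨ ∑-rotate L (λ a → [ row a Fin.≟ i ]) (cong (λ r → [ r Fin.≟ i ]) closed) ⟩
      ∑ (λ a → [ raisedRow a Fin.≟ i ])           ≡⟨ rowSum-cellCount raisedRow colAt i ⟨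
      rowSum raised i                            ∎

  raised-∤ : ∀ {i j} → raised i j ≢ 0 → ¬ t ∣ B i j
  raised-∤ r≢0 with cellCount-hit raisedRow colAt r≢0
  ... | a , row≡i , col≡j = subst₂ (λ i j → ¬ t ∣ B i j) row≡i col≡j (∤-raised (toℕ a) (Fin.toℕ<n a))

  lowered-∤ : ∀ {i j} → lowered i j ≢ 0 → ¬ t ∣ B i j
  lowered-∤ l≢0 with cellCount-hit loweredRow colAt l≢0
  ... | a , row≡i , col≡j = subst₂ (λ i j → ¬ t ∣ B i j) row≡i col≡j (∤-lowered (toℕ a) (Fin.toℕ<n a))

  on-cycle-or-fixed : ∀ i j → ¬ t ∣ B i j ⊎ shifted i j ≡ B i j
  on-cycle-or-fixed i j with raised i j ≟ 0 | lowered i j ≟ 0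
  ... | no  r≢0 | _        = inj₁ (raised-∤ r≢0)
  ... | yes _   | no  l≢0  = inj₁ (lowered-∤ l≢0)
  ... | yes r≡0 | yes l≡0  = inj₂ (begin
    B i j + δ * raised i j ∸ δ * lowered i j  ≡⟨ cong₂ (λ r l → B i j + δ * r ∸ δ * l) r≡0 l≡0 ⟩
    B i j + δ * 0 ∸ δ * 0                     ≡⟨ cong₂ (λ x y → B i j + x ∸ y) (*-zeroʳ δ) (*-zeroʳ δ) ⟩
    B i j + 0                                 ≡⟨ +-identityʳ _ ⟩
    B i j                                     ∎)

  shifted⊆B : shifted ⊆supp B
  shifted⊆B i j shifted≢0 with on-cycle-or-fixed i j
  ... | inj₁ t∤B = λ B≡0 → t∤B (subst (t ∣_) (sym B≡0) (t ∣0))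
  ... | inj₂ eq  = subst (_≢ 0) eq shifted≢0

  lowered-pivot : lowered (loweredRow a*) (colAt a*) ≡ 1
  lowered-pivot = ≤-antisym (lowered-≤1 _ _)
    (≤-trans (≤-reflexive (sym ([]-yes ((loweredRow a* Fin.≟ loweredRow a*) ×-dec (colAt a* Fin.≟ colAt a*))
                                       (refl , refl))))
             (≤-∑ (λ a → [ (loweredRow a Fin.≟ loweredRow a*) ×-dec (colAt a Fin.≟ colAt a*) ]) a*))

  shifted-pivot : shifted (loweredRow a*) (colAt a*) ≡ 0
  shifted-pivot = begin
    δ + δ * raised (loweredRow a*) (colAt a*) ∸ δ * lowered (loweredRow a*) (colAt a*)
      ≡⟨ cong₂ (λ r l → δ + δ * r ∸ δ * l) (proj₁ (proj₂ pivot)) lowered-pivot ⟩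
    δ + δ * 0 ∸ δ * 1  ≡⟨ cong₂ (λ x y → δ + x ∸ y) (*-zeroʳ δ) (*-identityʳ δ) ⟩
    δ + 0 ∸ δ          ≡⟨ m+n∸m≡n δ 0 ⟩
    0                  ∎

  nondivisible-≤ : ∀ i j → [ ¬? (t ∣? shifted i j) ] ≤ [ ¬? (t ∣? B i j) ]
  nondivisible-≤ i j with on-cycle-or-fixed i j
  ... | inj₁ t∤B = subst ([ ¬? (t ∣? shifted i j) ] ≤_) (sym ([]-yes (¬? (t ∣? B i j)) t∤B)) ([]-≤1 _)
  ... | inj₂ eq  = ≤-reflexive (cong (λ x → [ ¬? (t ∣? x) ]) eq)

  nondivisible-pivot : [ ¬? (t ∣? shifted (loweredRow a*) (colAt a*)) ] < [ ¬? (t ∣? δ) ]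
  nondivisible-pivot = subst₂ _<_
    (sym (trans (cong (λ x → [ ¬? (t ∣? x) ]) shifted-pivot) ([]-no (¬? (t ∣? 0)) (λ t∤0 → t∤0 (t ∣0)))))
    (sym ([]-yes (¬? (t ∣? δ)) (∤-lowered (toℕ a*) (Fin.toℕ<n a*))))
    (s≤s z≤n)

  nondivisibleCount-shifted : nondivisibleCount t shifted < nondivisibleCount t B
  nondivisibleCount-shifted =
    ∑-mono-< (λ i → ∑-mono-≤ (nondivisible-≤ i)) (loweredRow a*)
             (∑-mono-< (nondivisible-≤ (loweredRow a*)) (colAt a*) nondivisible-pivot)

-- Only the specifications of pivot and shift-along are used below; letting Agda unfold their
-- constructions makes type checking divide intractable.
opaque
  shift-along : ∀ {p t} {B : Matrix p} → AlternatingCycle t B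
              → Σ (Matrix p) λ B′ → SameLineSums B′ B × B′ ⊆supp B × nondivisibleCount t B′ < nondivisibleCount t B
  shift-along C = shifted , shifted-sums , shifted⊆B , nondivisibleCount-shifted
    where open Shift C

-- Finding an alternating cycle

module _ {p t} {B : Matrix p} (rows∣ : ∀ i → t ∣ rowSum B i) (cols∣ : ∀ j → t ∣ colSum B j) where

  NondivisibleEntry : Set
  NondivisibleEntry = Σ (Fin p) λ i → Σ (Fin p) λ j → ¬ t ∣ B i j

  turn-in-row : ∀ i j → ¬ t ∣ B i j → ∃ λ j′ → j′ ≢ j × ¬ t ∣ B i j′
  turn-in-row i j = ∣∑⇒∤-elsewhere (B i) j (rows∣ i)

  turn-in-col : ∀ i j → ¬ t ∣ B i j → ∃ λ i′ → i′ ≢ i × ¬ t ∣ B i′ j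
  turn-in-col i j = ∣∑⇒∤-elsewhere (λ k → B k j) i (cols∣ j)

  step : NondivisibleEntry → NondivisibleEntry
  step (i , j , t∤) = proj₁ down , proj₁ across , proj₂ (proj₂ down)
    where
    across = turn-in-row i j t∤
    down   = turn-in-col i (proj₁ across) (proj₂ (proj₂ across))

  module Walk (start : NondivisibleEntry) where

    walk : ℕ → NondivisibleEntry
    walk zero    = start
    walk (suc a) = step (walk a)

    -- The walk turns at (row a, col a) and (row (a + 1), col a).
    row col : ℕ → Fin p
    row a = proj₁ (walk a)
    col a = proj₁ (proj₂ (walk (suc a)))

    row-turns : ∀ a → row (suc a) ≢ row a
    row-turns a = proj₁ (proj₂ (turn-in-col _ _ (proj₂ (proj₂ (turn-in-row _ _ (proj₂ (proj₂ (walk a))))))))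

    col-turns : ∀ a → col (suc a) ≢ col a
    col-turns a = proj₁ (proj₂ (turn-in-row _ _ (proj₂ (proj₂ (walk (suc a))))))

    ∤-at-row : ∀ a → ¬ t ∣ B (row a) (col a)
    ∤-at-row a = proj₂ (proj₂ (turn-in-row _ _ (proj₂ (proj₂ (walk a)))))

    ∤-at-col : ∀ a → ¬ t ∣ B (row (suc a)) (col a)
    ∤-at-col a = proj₂ (proj₂ (walk (suc a)))

    Revisit : ℕ → Set
    Revisit m = ∃ λ q → q < m × row q ≡ row m

    first-revisit : ∃ λ m → Revisit m × (∀ k → k < m → ¬ Revisit k)
    first-revisit with Fin.pigeonhole (n<1+n p) (row ∘ toℕ)
    ... | q , m , q<m , row-eq = least (λ m → anyUpTo? (λ q → row q Fin.≟ row m) m) (toℕ q , q<m , row-eq)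

    cycle-from : ∀ {q m} → q < m → row q ≡ row m → (∀ k → k < m → ¬ Revisit k)
               → ∀ L → q + L ≡ m → AlternatingCycle t B
    cycle-from {q} q<m row-eq earlier zero q+0≡m =
      contradiction (trans (sym (+-identityʳ q)) q+0≡m) (<⇒≢ q<m)
    cycle-from {q} q<m row-eq earlier (suc zero) q+1≡m =
      contradiction (trans (cong row (trans (+-comm 1 q) q+1≡m)) (sym row-eq)) (row-turns q)
    cycle-from {q} {m} q<m row-eq earlier (suc (suc len)) q+L≡m = record
      { len       = len
      ; row       = row ∘ (q +_)
      ; col       = col ∘ (q +_)
      ; closed    = trans (cong row q+L≡m) (trans (sym row-eq) (cong row (sym (+-identityʳ q))))
      ; row-inj   = inj
      ; col-turns = subst₂ (λ x y → col x ≢ col y) (sym (+-comm q 1)) (sym (+-identityʳ q)) (col-turns q)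
      ; ∤-raised  = λ a _ → ∤-at-row (q + a)
      ; ∤-lowered = λ a _ → subst (λ x → ¬ t ∣ B (row x) (col (q + a))) (sym (+-suc q a)) (∤-at-col (q + a))
      }
      where
      before-m : ∀ {a} → a < 2 + len → q + a < m
      before-m a<L = subst (q + _ <_) q+L≡m (+-monoʳ-< q a<L)

      inj : ∀ {a b} → a < 2 + len → b < 2 + len → row (q + a) ≡ row (q + b) → a ≡ b
      inj {a} {b} a<L b<L eq with <-cmp a b
      ... | tri< a<b _ _ = contradiction (q + a , +-monoʳ-< q a<b , eq) (earlier (q + b) (before-m b<L))
      ... | tri≈ _ a≡b _ = a≡b
      ... | tri> _ _ b<a = contradiction (q + b , +-monoʳ-< q b<a , sym eq) (earlier (q + a) (before-m a<L))

    cycle : AlternatingCycle t B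
    cycle with first-revisit
    ... | m , (q , q<m , row-eq) , earlier = cycle-from q<m row-eq earlier (m ∸ q) (m+[n∸m]≡n (<⇒≤ q<m))

  nondivisible⇒cycle : NondivisibleEntry → AlternatingCycle t B
  nondivisible⇒cycle = Walk.cycle

-- Dividing line sums by t

record Divided {p} (t : ℕ) (B : Matrix p) : Set where
  field
    quotient        : Matrix p
    rowSum-quotient : ∀ i → t * rowSum quotient i ≡ rowSum B i
    colSum-quotient : ∀ j → t * colSum quotient j ≡ colSum B j
    quotient⊆B      : quotient ⊆supp B

divide-entrywise : ∀ {p} t .{{_ : NonZero t}} (B : Matrix p) → (∀ i j → t ∣ B i j) → Divided t B
divide-entrywise t B t∣B = record
  { quotient        = λ i j → B i j / t
  ; rowSum-quotient = λ i → trans (*-distribˡ-∑ t (λ j → B i j / t)) (∑-cong λ j → m*[n/m]≡n (t∣B i j))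
  ; colSum-quotient = λ j → trans (*-distribˡ-∑ t (λ i → B i j / t)) (∑-cong λ i → m*[n/m]≡n (t∣B i j))
  ; quotient⊆B      = λ i j q≢0 B≡0 → q≢0 (trans (cong (_/ t) B≡0) (0/n≡0 t))
  }

Divided-transport : ∀ {p t} {B B′ : Matrix p} → SameLineSums B′ B → B′ ⊆supp B → Divided t B′ → Divided t B
Divided-transport {t = t} (rows≡ , cols≡) B′⊆B D = record
  { quotient        = quotient
  ; rowSum-quotient = λ i → trans (rowSum-quotient i) (rows≡ i)
  ; colSum-quotient = λ j → trans (colSum-quotient j) (cols≡ j)
  ; quotient⊆B      = λ i j q≢0 → B′⊆B i j (quotient⊆B i j q≢0)
  }
  where open Divided D

divide : ∀ {p} t .{{_ : NonZero t}} (B : Matrix p)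
       → (∀ i → t ∣ rowSum B i) → (∀ j → t ∣ colSum B j) → Divided t B
divide {p} t B = go B (<-wellFounded _)
  where
  go : ∀ (B : Matrix p) → Acc _<_ (nondivisibleCount t B) → (∀ i → t ∣ rowSum B i) → (∀ j → t ∣ colSum B j) → Divided t B
  go B (acc smaller) rows∣ cols∣ with Fin.any? (λ i → Fin.any? (λ j → ¬? (t ∣? B i j)))
  ... | no  none  = divide-entrywise t B λ i j → decidable-stable (t ∣? B i j) (λ t∤ → none (i , j , t∤))
  ... | yes entry with shift-along (nondivisible⇒cycle rows∣ cols∣ entry)
  ... | B′ , (rows≡ , cols≡) , B′⊆B , fewer = Divided-transport (rows≡ , cols≡) B′⊆B
        (go B′ (smaller fewer) (λ i → subst (t ∣_) (sym (rows≡ i)) (rows∣ i))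
                               (λ j → subst (t ∣_) (sym (cols≡ j)) (cols∣ j)))

-- Extracting the matching

∸-≤-pred : ∀ {r t m} → r ≤ t → m ≤ 1 → (m ≡ 0 → r < t) → r ∸ m ≤ t ∸ 1
∸-≤-pred {t = zero} {m} z≤n m≤1 tight = ≤-reflexive (0∸n≡0 m)
∸-≤-pred {t = suc t} r≤t m≤1 tight with n≤1⇒n≡0∨n≡1 m≤1
... | inj₁ refl = ≤-pred (tight refl)
... | inj₂ refl = ∸-monoˡ-≤ 1 r≤t

≤1⇒≤ : ∀ {x y} → x ≤ 1 → (x ≢ 0 → y ≢ 0) → x ≤ y
≤1⇒≤ {y = y} x≤1 support with n≤1⇒n≡0∨n≡1 x≤1 | y ≟ 0
... | inj₁ refl | _         = z≤n
... | inj₂ refl | no  y≢0   = n≢0⇒n>0 y≢0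
... | inj₂ refl | yes y≡0   = contradiction y≡0 (support (λ ()))

module _ {n} {N M : Matrix n} (M≤N : ∀ i j → M i j ≤ N i j) where

  rowSum-⊖ : ∀ i → rowSum (N ⊖ M) i ≡ rowSum N i ∸ rowSum M i
  rowSum-⊖ i = trans (sym (m+n∸n≡m _ (rowSum M i))) (cong (_∸ rowSum M i) (∑-∸ (N i) (M i) (M≤N i)))

  colSum-⊖ : ∀ j → colSum (N ⊖ M) j ≡ colSum N j ∸ colSum M j
  colSum-⊖ j = trans (sym (m+n∸n≡m _ (colSum M j)))
                     (cong (_∸ colSum M j) (∑-∸ (λ i → N i j) (λ i → M i j) (λ i → M≤N i j)))

  totalSum-⊖ : totalSum (N ⊖ M) + totalSum M ≡ totalSum N
  totalSum-⊖ = trans (sym (∑-distrib-+ (rowSum (N ⊖ M)) (rowSum M))) (∑-cong λ i → ∑-∸ (N i) (M i) (M≤N i))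

pad : ∀ {n} → ℕ → Matrix n → Matrix (suc n)
pad t N zero    zero    = 0
pad t N zero    (suc j) = t ∸ colSum N j
pad t N (suc i) zero    = t ∸ rowSum N i
pad t N (suc i) (suc j) = N i j

∑-slack : ∀ {n t k} (s : Fin n → ℕ) → (∀ i → s i ≤ t) → ∑ s ≡ t * k → ∑ (λ i → t ∸ s i) + t * k ≡ t * n
∑-slack {n} {t} {k} s s≤t ∑s≡tk = begin
  ∑ (λ i → t ∸ s i) + t * k    ≡⟨ cong (∑ (λ i → t ∸ s i) +_) ∑s≡tk ⟨
  ∑ (λ i → t ∸ s i) + ∑ s      ≡⟨ ∑-∸ (λ _ → t) s s≤t ⟩
  ∑ {n} (λ _ → t)              ≡⟨ ∑-const {n} t ⟩
  n * t                        ≡⟨ *-comm n t ⟩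
  t * n                        ∎

∣∑-slack : ∀ {n t k} (s : Fin n → ℕ) → (∀ i → s i ≤ t) → ∑ s ≡ t * k → t ∣ ∑ (λ i → t ∸ s i)
∣∑-slack {n} {t} {k} s s≤t ∑s≡tk =
  ∣m+n∣m⇒∣n (subst (t ∣_) (trans (sym (∑-slack s s≤t ∑s≡tk)) (+-comm _ (t * k))) (m∣m*n n)) (m∣m*n k)

module Extraction {n t k} .{{_ : NonZero t}} (N : Matrix n)
  (rows≤ : ∀ i → rowSum N i ≤ t) (cols≤ : ∀ j → colSum N j ≤ t) (total : totalSum N ≡ t * k) where

  padded-rows∣ : ∀ i → t ∣ rowSum (pad t N) i
  padded-rows∣ zero    = ∣∑-slack (colSum N) cols≤ (trans (sym (∑-comm N)) total)
  padded-rows∣ (suc i) = subst (t ∣_) (sym (m∸n+n≡m (rows≤ i))) ∣-refl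

  padded-cols∣ : ∀ j → t ∣ colSum (pad t N) j
  padded-cols∣ zero    = ∣∑-slack (rowSum N) rows≤ total
  padded-cols∣ (suc j) = subst (t ∣_) (sym (m∸n+n≡m (cols≤ j))) ∣-refl

  open Divided (divide t (pad t N) padded-rows∣ padded-cols∣) renaming (quotient to Q)

  M : Matrix n
  M i j = Q (suc i) (suc j)

  slack+rowSum : ∀ i → Q (suc i) zero + rowSum M i ≡ 1
  slack+rowSum i = *-cancelˡ-≡ (Q (suc i) zero + rowSum M i) 1 t
    (trans (rowSum-quotient (suc i)) (trans (m∸n+n≡m (rows≤ i)) (sym (*-identityʳ t))))

  slack+colSum : ∀ j → Q zero (suc j) + colSum M j ≡ 1
  slack+colSum j = *-cancelˡ-≡ (Q zero (suc j) + colSum M j) 1 t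
    (trans (colSum-quotient (suc j)) (trans (m∸n+n≡m (cols≤ j)) (sym (*-identityʳ t))))

  rowSum-M-≤1 : ∀ i → rowSum M i ≤ 1
  rowSum-M-≤1 i = subst (rowSum M i ≤_) (slack+rowSum i) (m≤n+m _ _)

  colSum-M-≤1 : ∀ j → colSum M j ≤ 1
  colSum-M-≤1 j = subst (colSum M j ≤_) (slack+colSum j) (m≤n+m _ _)

  M-≤1 : ∀ i j → M i j ≤ 1
  M-≤1 i j = ≤-trans (≤-∑ (M i) j) (rowSum-M-≤1 i)

  M≤N : ∀ i j → M i j ≤ N i j
  M≤N i j = ≤1⇒≤ (M-≤1 i j) (quotient⊆B (suc i) (suc j))

  M-induced : InInducedGraph N M
  M-induced i j M≡1 = quotient⊆B (suc i) (suc j) (λ M≡0 → contradiction (trans (sym M≡1) M≡0) (λ ()))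

  unmatched-row-slack : ∀ i → rowSum M i ≡ 0 → rowSum N i < t
  unmatched-row-slack i M≡0 = m∸n≢0⇒n<m (quotient⊆B (suc i) zero λ Q≡0 →
    contradiction (trans (sym (slack+rowSum i)) (cong₂ _+_ Q≡0 M≡0)) (λ ()))

  unmatched-col-slack : ∀ j → colSum M j ≡ 0 → colSum N j < t
  unmatched-col-slack j M≡0 = m∸n≢0⇒n<m (quotient⊆B zero (suc j) λ Q≡0 →
    contradiction (trans (sym (slack+colSum j)) (cong₂ _+_ Q≡0 M≡0)) (λ ()))

  corner : Q zero zero ≡ 0
  corner with Q zero zero ≟ 0
  ... | yes Q≡0 = Q≡0
  ... | no  Q≢0 = contradiction refl (quotient⊆B zero zero Q≢0)

  unmatchedRows : ℕ
  unmatchedRows = ∑ λ i → Q (suc i) zero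

  unmatchedRows+k : unmatchedRows + k ≡ n
  unmatchedRows+k = *-cancelˡ-≡ (unmatchedRows + k) n t (begin
    t * (unmatchedRows + k)                    ≡⟨ *-distribˡ-+ t unmatchedRows k ⟩
    t * unmatchedRows + t * k                  ≡⟨ cong (λ x → t * (x + unmatchedRows) + t * k) corner ⟨
    t * colSum Q zero + t * k                  ≡⟨ cong (_+ t * k) (colSum-quotient zero) ⟩
    ∑ (λ i → t ∸ rowSum N i) + t * k           ≡⟨ ∑-slack (rowSum N) rows≤ total ⟩
    t * n                                      ∎)

  totalSum-M+unmatchedRows : totalSum M + unmatchedRows ≡ n
  totalSum-M+unmatchedRows = begin
    totalSum M + unmatchedRows                 ≡⟨ ∑-distrib-+ (rowSum M) (λ i → Q (suc i) zero) ⟨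
    ∑ (λ i → rowSum M i + Q (suc i) zero)      ≡⟨ ∑-cong (λ i → trans (+-comm (rowSum M i) _) (slack+rowSum i)) ⟩
    ∑ {n} (λ _ → 1)                            ≡⟨ ∑-const {n} 1 ⟩
    n * 1                                      ≡⟨ *-identityʳ n ⟩
    n                                          ∎

  totalSum-M : totalSum M ≡ k
  totalSum-M = +-cancelʳ-≡ unmatchedRows _ _
    (trans totalSum-M+unmatchedRows (trans (sym unmatchedRows+k) (+-comm unmatchedRows k)))

  totalSum-N⊖M : totalSum (N ⊖ M) ≡ (t ∸ 1) * k
  totalSum-N⊖M = begin
    totalSum (N ⊖ M)                    ≡⟨ m+n∸n≡m _ k ⟨
    totalSum (N ⊖ M) + k ∸ k            ≡⟨ cong (λ x → totalSum (N ⊖ M) + x ∸ k) totalSum-M ⟨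
    totalSum (N ⊖ M) + totalSum M ∸ k   ≡⟨ cong (_∸ k) (totalSum-⊖ M≤N) ⟩
    totalSum N ∸ k                      ≡⟨ cong₂ _∸_ total (sym (*-identityˡ k)) ⟩
    t * k ∸ 1 * k                       ≡⟨ *-distribʳ-∸ k t 1 ⟨
    (t ∸ 1) * k                         ∎

  M-kMatching : IsKMatching k M
  M-kMatching = (λ i j → n≤1⇒n≡0∨n≡1 (M-≤1 i j)) , rowSum-M-≤1 , colSum-M-≤1 , totalSum-M

  N⊖M-polytope : InScaledMatchingPolytope (t ∸ 1) k (N ⊖ M)
  N⊖M-polytope =
      (λ i → subst (_≤ t ∸ 1) (sym (rowSum-⊖ M≤N i)) (∸-≤-pred (rows≤ i) (rowSum-M-≤1 i) (unmatched-row-slack i)))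
    , (λ j → subst (_≤ t ∸ 1) (sym (colSum-⊖ M≤N j)) (∸-≤-pred (cols≤ j) (colSum-M-≤1 j) (unmatched-col-slack j)))
    , totalSum-N⊖M

lemma4p6 : (n t k : ℕ) → 1 ≤ n → 1 ≤ t → k ≤ n → (N : Matrix n)
    → InScaledMatchingPolytope t k N
    → Σ (Matrix n) (λ M → IsKMatching k M × InInducedGraph N M
        × InScaledMatchingPolytope (t ∸ 1) k (N ⊖ M))
lemma4p6 n (suc t) k _ _ _ N (rows≤ , cols≤ , total) = M , M-kMatching , M-induced , N⊖M-polytope
  where open Extraction N rows≤ cols≤ total
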